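{- Let $H$ and $G$ be graphs with $|V(H)|\le \ell-1$ and $n=|V(G)|$. If there is no copy $H'$ of $H$ in $G$ with $|V(B_1(H',G))|\geq \ell$, then the number of connected components of $G$ isomorphic to $H$ can be reconstructed from $\mathcal{D}_\ell(G)$, i.e. it equals the number of components isomorphic to $H$ of any graph $G'$ with $\mathcal{D}_\ell(G')=\mathcal{D}_\ell(G)$.
   Context: All graphs are finite, simple and undirected. For a graph $G$ and an integer $\ell$, the $\ell$-deck $\mathcal{D}_\ell(G)$ is the multiset of isomorphism classes of all induced subgraphs of $G$ on exactly $\ell$ vertices (one per $\ell$-subset of $V(G)$). A copy of $H$ in $G$ is an induced subgraph of $G$ isomorphic to $H$. For an induced subgraph $H'$ of $G$, $B_1(H',G)$ is the subgraph of $G$ induced by all vertices at distance at most $1$ from $V(H')$. -}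

module Defs where

open import Data.Nat using (ℕ; zero; suc; _≤_)
open import Data.Bool using (Bool; true; false; _∨_; _∧_)
open import Data.Fin using (Fin)
open import Data.Fin.Subset using (Subset; _∈_; ∣_∣; ⊤)
open import Data.Vec using (Vec; lookup; tabulate)
open import Data.Product using (Σ; _×_; ∃)
open import Data.List using (List)
open import Data.List.Relation.Unary.Unique.Propositional using (Unique)
import Data.List.Membership.Propositional as LM
open import Relation.Binary.PropositionalEquality using (_≡_)
open import Function.Bundles using (_↔_; Inverse)

record Graph : Set where
  field
    n     : ℕ
    adj   : Fin n → Fin n → Bool
    sym   : ∀ u v → adj u v ≡ adj v u
    irrefl : ∀ v → adj v v ≡ false
open Graph public

VSub : (G : Graph) → Subset (n G) → Set
VSub G S = Σ (Fin (n G)) (λ v → v ∈ S)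

record Iso (G : Graph) (S : Subset (n G)) (G' : Graph) (S' : Subset (n G')) : Set where
  field
    bij : VSub G S ↔ VSub G' S'
    pres : ∀ (x y : VSub G S) →
      adj G (Σ.proj₁ x) (Σ.proj₁ y) ≡
      adj G' (Σ.proj₁ (Inverse.to bij x)) (Σ.proj₁ (Inverse.to bij y))

_[_]≅_ : (G : Graph) → Subset (n G) → Graph → Set
G [ S ]≅ H = Iso G S H ⊤

-- ℓ-subsets of V(G), i.e. the cards of the ℓ-deck (one per ℓ-subset).
Cards : ℕ → Graph → Set
Cards ℓ G = Σ (Subset (n G)) (λ S → ∣ S ∣ ≡ ℓ)

-- D_ℓ(G) = D_ℓ(G') as multisets of isomorphism classes: a bijection between
-- the ℓ-subsets of V(G) and of V(G') matching isomorphic induced subgraphs.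
SameDeck : ℕ → Graph → Graph → Set
SameDeck ℓ G G' =
  Σ (Cards ℓ G ↔ Cards ℓ G') λ f →
    ∀ (c : Cards ℓ G) →
      Iso G (Σ.proj₁ c) G' (Σ.proj₁ (Inverse.to f c))

data WalkIn (G : Graph) (S : Subset (n G)) : Fin (n G) → Fin (n G) → Set where
  here : ∀ {u} → u ∈ S → WalkIn G S u u
  step : ∀ {u w v} → u ∈ S → adj G u w ≡ true → WalkIn G S w v → WalkIn G S u v

record IsComponent (G : Graph) (S : Subset (n G)) : Set where
  field
    nonempty  : ∃ λ v → v ∈ S
    connected : ∀ u v → u ∈ S → v ∈ S → WalkIn G S u v
    closed    : ∀ u v → u ∈ S → adj G u v ≡ true → v ∈ S

ComponentIso : (G H : Graph) → Subset (n G) → Set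
ComponentIso G H S = IsComponent G S × (G [ S ]≅ H)

NumComponentsIso : (G H : Graph) → ℕ → Set
NumComponentsIso G H k =
  Σ (List (Subset (n G))) λ L →
    Unique L × (Data.List.length L ≡ k) ×
    (∀ S → (S LM.∈ L → ComponentIso G H S) × (ComponentIso G H S → S LM.∈ L))
  where import Data.List

anyFin : ∀ {m} → (Fin m → Bool) → Bool
anyFin {zero} f = false
anyFin {suc m} f = f Fin.zero ∨ anyFin (λ i → f (Fin.suc i))

ball1 : (G : Graph) → Subset (n G) → Subset (n G)
ball1 G S = tabulate λ v → lookup S v ∨ anyFin (λ u → lookup S u ∧ adj G u v)

-- Write ∂S = B₁(S) ∖ S for a copy S of H, and K = ℓ − |V(H)|. Double counting the pairs
-- (S, C) of a copy S and an ℓ-card C ⊇ S with |C ∩ ∂S| = i shows that, for every i ≤ K, the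
-- deck determines  Σⱼ cⱼ · (j choose i) · ((|V(G)| − |V(H)| − j) choose (K − i)),  where cⱼ is
-- the number of copies with |∂S| = j. The hypothesis says cⱼ(G) = 0 for j ≥ K; the equation
-- for i = K then forces the same in G′, and the equations for i < K form a triangular system
-- with nonzero diagonal (|V(G)| ≥ ℓ, and |V(G)| is read off the number of cards), so
-- c₀(G) = c₀(G′). If H is connected, the components isomorphic to H are exactly the copies
-- with empty boundary; if not, neither graph has such a component.

module Submission where

open import Defs hiding (sym)
open import Data.Bool using (Bool; true; false; T; _∨_; _∧_; if_then_else_)
open import Data.Bool.Properties using (T-∨; T-∧; T-≡) renaming (_≟_ to _≟ᵇ_)
open import Data.Empty using (⊥)
open import Data.Fin using (Fin; zero; suc) renaming (_≟_ to _≟ᶠ_)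
open import Data.Fin.Permutation using (↔⇒≡)
open import Data.Fin.Properties using (any?; all?; ¬Fin0)
open import Data.Fin.Subset
  using (Subset; Nonempty; ⊤; inside; outside; _∈_; _∉_; _⊆_; _∩_; _─_; ∁; ∣_∣) renaming (⊥ to ∅)
open import Data.Fin.Subset.Properties
  using ( _∈?_; _⊆?_; ∈⊤; drop-there; drop-∷-⊆; Empty-unique; ∣⊥∣≡0; ∣⊤∣≡n; ∣∁p∣≡n∸∣p∣; ⊆-antisym
        ; p∩q⊆p; x∈p∩q⁺; x∈p∩q⁻; x∈p∧x∉q⇒x∈p─q)
open import Data.List using (List; []; _∷_; _++_; [_]; map; filter; length; upTo)
open import Data.List.Membership.Propositional using () renaming (_∈_ to _∈ₗ_)
open import Data.List.Membership.Propositional.Properties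
  using (∈-map⁺; ∈-map⁻; ∈-++⁺ˡ; ∈-++⁺ʳ; ∈-filter⁺; ∈-filter⁻; ∈-upTo⁺; ∈-upTo⁻)
open import Data.List.Membership.Propositional.Properties.WithK using (unique∧set⇒bag)
open import Data.List.Properties using (map-++; map-∘; map-cong-local; map-id-local)
open import Data.List.Relation.Binary.BagAndSetEquality using (∼bag⇒↭)
import Data.List.Relation.Binary.Permutation.Propositional.Properties as ↭
open import Data.List.Relation.Unary.All as All using (All)
open import Data.List.Relation.Unary.AllPairs using ([]; _∷_)
import Data.List.Relation.Unary.Any as Any
open import Data.List.Relation.Unary.Unique.Propositional using (Unique)
import Data.List.Relation.Unary.Unique.Propositional.Properties as Unique
open import Data.Nat using (ℕ; zero; suc; _+_; _*_; _∸_; _≤_; _<_; z≤n; s≤s; z<s; _≤?_; NonZero; >-nonZero)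
open import Data.Nat.Combinatorics using (k>n⇒nCk≡0; nCk+nC[k+1]≡[n+1]C[k+1]) renaming (_C_ to _choose_)
open import Data.Nat.ListAction using (sum)
open import Data.Nat.ListAction.Properties using (sum-++; sum-↭)
open import Data.Nat.Properties
open import Algebra.Properties.CommutativeSemigroup +-commutativeSemigroup
  using () renaming (interchange to +-interchange)
open import Data.Product using (Σ; ∃; ∃-syntax; _×_; _,_; proj₁; proj₂)
import Data.Product as Product
open import Data.Sum as Sum using (_⊎_; inj₁; inj₂)
open import Data.Vec using ([]; _∷_; lookup; tabulate; here; there)
open import Data.Vec.Functional using (Vector) renaming (_∷_ to _∷ᶠ_)
open import Data.Vec.Properties using ([]=⇒lookup; lookup⇒[]=; lookup∘tabulate)
open import Data.Vec.Properties.WithK using ([]=-irrelevant)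
open import Function using (_∘_; _⇔_; mk⇔; Equivalence)
open import Function.Bundles using (_↔_; Inverse; mk↔ₛ′)
open import Function.Properties.Inverse using (↔-sym; ↔-trans)
open import Relation.Binary.Definitions using (DecidableEquality; tri<; tri≈; tri>)
open import Relation.Binary.PropositionalEquality
  using (_≡_; _≢_; _≗_; refl; sym; trans; cong; cong₂; subst; subst₂; module ≡-Reasoning)
open import Relation.Nullary using (¬_; Dec; does; yes; no; contradiction)
open import Relation.Nullary.Decidable using (map′; _×-dec_; _→-dec_)
open import Relation.Unary using (Decidable)

private
  variable
    A B : Set

-- Finite sums

∑ : List A → (A → ℕ) → ℕ
∑ xs f = sum (map f xs)

⟦_⟧ : {P : Set} → Dec P → ℕ
⟦ P? ⟧ = if does P? then 1 else 0

⟦⟧-cong : ∀ {P Q : Set} → P ⇔ Q → (P? : Dec P) (Q? : Dec Q) → ⟦ P? ⟧ ≡ ⟦ Q? ⟧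
⟦⟧-cong P⇔Q (yes p) (yes q) = refl
⟦⟧-cong P⇔Q (yes p) (no ¬q) = contradiction (Equivalence.to P⇔Q p) ¬q
⟦⟧-cong P⇔Q (no ¬p) (yes q) = contradiction (Equivalence.from P⇔Q q) ¬p
⟦⟧-cong P⇔Q (no ¬p) (no ¬q) = refl

⟦×⟧ : ∀ {P Q : Set} (P? : Dec P) (Q? : Dec Q) → ⟦ P? ⟧ * ⟦ Q? ⟧ ≡ ⟦ P? ×-dec Q? ⟧
⟦×⟧ (yes _) Q? = +-identityʳ ⟦ Q? ⟧
⟦×⟧ (no _)  Q? = refl

⟦×⟧³ : ∀ {P Q R S : Set} (P? : Dec P) (Q? : Dec Q) (R? : Dec R) (S? : Dec S) →
       ⟦ P? ⟧ * (⟦ Q? ⟧ * (⟦ R? ⟧ * ⟦ S? ⟧)) ≡ ⟦ P? ×-dec Q? ×-dec R? ×-dec S? ⟧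
⟦×⟧³ P? Q? R? S? =
  trans (cong (⟦ P? ⟧ *_) (trans (cong (⟦ Q? ⟧ *_) (⟦×⟧ R? S?)) (⟦×⟧ Q? (R? ×-dec S?))))
        (⟦×⟧ P? (Q? ×-dec R? ×-dec S?))

⟦yes⟧ : ∀ {P : Set} (P? : Dec P) → P → ⟦ P? ⟧ ≡ 1
⟦yes⟧ (yes _) _ = refl
⟦yes⟧ (no ¬p) p = contradiction p ¬p

⟦⟧*-cong : ∀ {P : Set} (P? : Dec P) {a b : ℕ} → (P → a ≡ b) → ⟦ P? ⟧ * a ≡ ⟦ P? ⟧ * b
⟦⟧*-cong (yes p) a≡b = cong (_+ 0) (a≡b p)
⟦⟧*-cong (no _)  a≡b = refl

∑-zero : ∀ (xs : List A) {f : A → ℕ} → (∀ {x} → x ∈ₗ xs → f x ≡ 0) → ∑ xs f ≡ 0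
∑-zero []       f≡0 = refl
∑-zero (x ∷ xs) f≡0 = cong₂ _+_ (f≡0 (Any.here refl)) (∑-zero xs (f≡0 ∘ Any.there))

∑-cong : ∀ (xs : List A) {f g : A → ℕ} → (∀ {x} → x ∈ₗ xs → f x ≡ g x) → ∑ xs f ≡ ∑ xs g
∑-cong []       f≡g = refl
∑-cong (x ∷ xs) f≡g = cong₂ _+_ (f≡g (Any.here refl)) (∑-cong xs (f≡g ∘ Any.there))

∑-distrib-+ : ∀ (xs : List A) (f g : A → ℕ) → ∑ xs (λ x → f x + g x) ≡ ∑ xs f + ∑ xs g
∑-distrib-+ []       f g = refl
∑-distrib-+ (x ∷ xs) f g =
  trans (cong (f x + g x +_) (∑-distrib-+ xs f g)) (+-interchange (f x) (g x) (∑ xs f) (∑ xs g))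

∑-*ˡ : ∀ (xs : List A) k (f : A → ℕ) → ∑ xs (λ x → k * f x) ≡ k * ∑ xs f
∑-*ˡ []       k f = sym (*-zeroʳ k)
∑-*ˡ (x ∷ xs) k f = trans (cong (k * f x +_) (∑-*ˡ xs k f)) (sym (*-distribˡ-+ k (f x) _))

∑-*ʳ : ∀ (xs : List A) k (f : A → ℕ) → ∑ xs (λ x → f x * k) ≡ ∑ xs f * k
∑-*ʳ xs k f = trans (∑-cong xs (λ {x} _ → *-comm (f x) k)) (trans (∑-*ˡ xs k f) (*-comm k _))

∑-comm : ∀ (xs : List A) (ys : List B) (f : A → B → ℕ) →
         ∑ xs (λ x → ∑ ys (f x)) ≡ ∑ ys (λ y → ∑ xs (λ x → f x y))
∑-comm []       ys f = sym (∑-zero ys (λ _ → refl))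
∑-comm (x ∷ xs) ys f =
  trans (cong (∑ ys (f x) +_) (∑-comm xs ys f)) (sym (∑-distrib-+ ys (f x) _))

∑-filter : ∀ {P : A → Set} (P? : Decidable P) (xs : List A) (f : A → ℕ) →
           ∑ (filter P? xs) f ≡ ∑ xs (λ x → ⟦ P? x ⟧ * f x)
∑-filter P? []       f = refl
∑-filter P? (x ∷ xs) f with does (P? x)
... | true  = cong₂ _+_ (sym (+-identityʳ (f x))) (∑-filter P? xs f)
... | false = ∑-filter P? xs f

length≡∑1 : ∀ (xs : List A) → length xs ≡ ∑ xs (λ _ → 1)
length≡∑1 []       = refl
length≡∑1 (_ ∷ xs) = cong suc (length≡∑1 xs)

∑≡0⇒ : ∀ (xs : List A) (f : A → ℕ) → ∑ xs f ≡ 0 → ∀ {x} → x ∈ₗ xs → f x ≡ 0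
∑≡0⇒ (y ∷ xs) f ∑≡0 (Any.here refl) = m+n≡0⇒m≡0 (f y) ∑≡0
∑≡0⇒ (y ∷ xs) f ∑≡0 (Any.there x∈) = ∑≡0⇒ xs f (m+n≡0⇒n≡0 (f y) ∑≡0) x∈

∑-reindex : ∀ {xs : List A} {ys : List B} → Unique xs → Unique ys →
  (f : A → B) (g : B → A) →
  (∀ {x} → x ∈ₗ xs → f x ∈ₗ ys) → (∀ {y} → y ∈ₗ ys → g y ∈ₗ xs) →
  (∀ {x} → x ∈ₗ xs → g (f x) ≡ x) → (∀ {y} → y ∈ₗ ys → f (g y) ≡ y) →
  (w : A → ℕ) (w′ : B → ℕ) → (∀ {x} → x ∈ₗ xs → w′ (f x) ≡ w x) →
  ∑ xs w ≡ ∑ ys w′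
∑-reindex {xs = xs} {ys} xs! ys! f g f∈ g∈ gf fg w w′ w′f = begin
  sum (map w xs)             ≡⟨ cong sum (map-cong-local (All.tabulate (sym ∘ w′f))) ⟩
  sum (map (w′ ∘ f) xs)      ≡⟨ cong sum (map-∘ xs) ⟩
  sum (map w′ (map f xs))    ≡⟨ sum-↭ (↭.map⁺ w′ fxs↭ys) ⟩
  sum (map w′ ys)            ∎
  where
  open ≡-Reasoning
  gfxs≡xs : map g (map f xs) ≡ xs
  gfxs≡xs = trans (sym (map-∘ xs)) (map-id-local (All.tabulate gf))
  fxs! : Unique (map f xs)
  fxs! = Unique.map⁻ (subst Unique (sym gfxs≡xs) xs!)
  fxs↭ys = ∼bag⇒↭ (unique∧set⇒bag fxs! ys! (mk⇔ into onto))
    where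
    into : ∀ {y} → y ∈ₗ map f xs → y ∈ₗ ys
    into y∈ with x , x∈ , refl ← ∈-map⁻ f y∈ = f∈ x∈
    onto : ∀ {y} → y ∈ₗ ys → y ∈ₗ map f xs
    onto y∈ = subst (_∈ₗ map f xs) (fg y∈) (∈-map⁺ f (g∈ y∈))

module _ (_≟_ : DecidableEquality A) where

  ∑-δ : ∀ {xs : List A} → Unique xs → ∀ {d} → d ∈ₗ xs → (F : A → ℕ) →
        ∑ xs (λ x → ⟦ d ≟ x ⟧ * F x) ≡ F d
  ∑-δ {x ∷ xs} (x∉xs ∷ xs!) (Any.here refl) F with x ≟ x
  ... | no x≢x = contradiction refl x≢x
  ... | yes _  = trans (cong₂ _+_ (+-identityʳ (F x)) (∑-zero xs off)) (+-identityʳ (F x))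
    where
    off : ∀ {y} → y ∈ₗ xs → ⟦ x ≟ y ⟧ * F y ≡ 0
    off {y} y∈ with x ≟ y
    ... | yes refl = contradiction refl (All.lookup x∉xs y∈)
    ... | no _     = refl
  ∑-δ {x ∷ xs} (x∉xs ∷ xs!) {d} (Any.there d∈) F with d ≟ x
  ... | yes d≡x = contradiction (sym d≡x) (All.lookup x∉xs d∈)
  ... | no _     = ∑-δ xs! d∈ F

  ∑-cancel-at : ∀ {xs : List A} → Unique xs → ∀ {i} → i ∈ₗ xs → (f g : A → ℕ) →
                (∀ {j} → j ∈ₗ xs → j ≢ i → f j ≡ g j) → ∑ xs f ≡ ∑ xs g → f i ≡ g i
  ∑-cancel-at {x ∷ xs} (x∉xs ∷ xs!) (Any.here refl) f g f≡g ∑≡ =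
    +-cancelʳ-≡ (∑ xs f) (f x) (g x) (trans ∑≡ (cong (g x +_) (sym rest)))
    where
    rest : ∑ xs f ≡ ∑ xs g
    rest = ∑-cong xs (λ j∈ → f≡g (Any.there j∈) (λ { refl → All.lookup x∉xs j∈ refl }))
  ∑-cancel-at {x ∷ xs} (x∉xs ∷ xs!) (Any.there i∈) f g f≡g ∑≡ =
    ∑-cancel-at xs! i∈ f g (f≡g ∘ Any.there) (+-cancelˡ-≡ (f x) _ _ (trans ∑≡ (cong (_+ ∑ xs g) (sym fx≡gx))))
    where
    fx≡gx : f x ≡ g x
    fx≡gx = f≡g (Any.here refl) (λ { refl → All.lookup x∉xs i∈ refl })

triangular-unique : ∀ K (M : ℕ → ℕ → ℕ) →
  (∀ {j i} → j < i → M j i ≡ 0) → (∀ {i} → i < K → NonZero (M i i)) →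
  (a b : ℕ → ℕ) →
  (∀ {i} → i < K → ∑ (upTo K) (λ j → a j * M j i) ≡ ∑ (upTo K) (λ j → b j * M j i)) →
  ∀ {i} → i < K → a i ≡ b i
triangular-unique K M upper diagonal a b equations i<K = solvedBelow K i<K (m≤n+m K _)
  where
  solvedBelow : ∀ t {i} → i < K → K ≤ i + t → a i ≡ b i
  solvedBelow zero {i} i<K K≤i+0 = contradiction (subst (K ≤_) (+-identityʳ i) K≤i+0) (<⇒≱ i<K)
  solvedBelow (suc t) {i} i<K K≤i+1+t =
    *-cancelʳ-≡ (a i) (b i) (M i i) {{diagonal i<K}}
      (∑-cancel-at _≟_ (Unique.upTo⁺ K) (∈-upTo⁺ i<K) (λ j → a j * M j i) (λ j → b j * M j i)
                   others (equations i<K))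
    where
    others : ∀ {j} → j ∈ₗ upTo K → j ≢ i → a j * M j i ≡ b j * M j i
    others {j} j∈ j≢i with <-cmp j i
    ... | tri< j<i _ _ rewrite upper j<i = trans (*-zeroʳ (a j)) (sym (*-zeroʳ (b j)))
    ... | tri≈ _ j≡i _ = contradiction j≡i j≢i
    ... | tri> _ _ i<j = cong (_* M j i) (solvedBelow t (∈-upTo⁻ j∈) K≤j+t)
      where
      K≤j+t : K ≤ j + t
      K≤j+t = ≤-trans K≤i+1+t (subst (_≤ j + t) (sym (+-suc i t)) (+-monoˡ-≤ t i<j))

-- Binomial coefficients

*-pos : ∀ {m n} → 0 < m → 0 < n → 0 < m * n
*-pos {suc m} {suc n} _ _ = s≤s z≤n

0<nCk : ∀ {n k} → k ≤ n → 0 < n choose k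
0<nCk {n}     {zero}  _         = s≤s z≤n
0<nCk {suc n} {suc k} (s≤s k≤n) =
  subst (0 <_) (nCk+nC[k+1]≡[n+1]C[k+1] n k) (≤-trans (0<nCk k≤n) (m≤m+n _ _))

nC[k+1]<[n+1]C[k+1] : ∀ {n k} → k ≤ n → n choose suc k < suc n choose suc k
nC[k+1]<[n+1]C[k+1] {n} {k} k≤n =
  subst (n choose suc k <_) (nCk+nC[k+1]≡[n+1]C[k+1] n k) (+-monoˡ-≤ (n choose suc k) (0<nCk k≤n))

pascal-*ʳ : ∀ t k c → (t choose suc k) * c + (t choose k) * c ≡ (suc t choose suc k) * c
pascal-*ʳ t k c = trans (sym (*-distribʳ-+ c (t choose suc k) _))
                        (cong (_* c) (trans (+-comm (t choose suc k) _) (nCk+nC[k+1]≡[n+1]C[k+1] t k)))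

pascal-*ˡ : ∀ c t k → c * (t choose suc k) + c * (t choose k) ≡ c * (suc t choose suc k)
pascal-*ˡ c t k = trans (sym (*-distribˡ-+ c (t choose suc k) _))
                        (cong (c *_) (trans (+-comm (t choose suc k) _) (nCk+nC[k+1]≡[n+1]C[k+1] t k)))

C-monoˡ-≤ : ∀ k {n n′} → n ≤ n′ → n choose k ≤ n′ choose k
C-monoˡ-≤ k {n′ = zero}   z≤n = ≤-refl
C-monoˡ-≤ k {n′ = suc n′} n≤ with m≤n⇒m<n∨m≡n n≤
... | inj₂ refl         = ≤-refl
... | inj₁ (s≤s n≤n′)   = ≤-trans (C-monoˡ-≤ k n≤n′) (nCk≤[n+1]Ck k)
  where
  nCk≤[n+1]Ck : ∀ k → n′ choose k ≤ suc n′ choose k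
  nCk≤[n+1]Ck zero    = ≤-refl
  nCk≤[n+1]Ck (suc k) = subst (n′ choose suc k ≤_) (nCk+nC[k+1]≡[n+1]C[k+1] n′ k) (m≤n+m _ _)

C-injectiveˡ : ∀ {n n′ k} → 0 < k → k ≤ n → n choose k ≡ n′ choose k → n ≡ n′
C-injectiveˡ {n} {n′} {suc k} _ k<n eq with <-cmp n n′
... | tri≈ _ n≡n′ _ = n≡n′
... | tri< n<n′ _ _ =
  contradiction eq (<⇒≢ (<-≤-trans (nC[k+1]<[n+1]C[k+1] (≤-trans (n≤1+n k) k<n)) (C-monoˡ-≤ (suc k) n<n′)))
... | tri> _ _ n′<n with suc k ≤? n′
...   | yes k<n′ =
  contradiction (sym eq)
    (<⇒≢ (<-≤-trans (nC[k+1]<[n+1]C[k+1] (≤-trans (n≤1+n k) k<n′)) (C-monoˡ-≤ (suc k) n′<n)))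
...   | no  k≮n′ = contradiction (trans eq (k>n⇒nCk≡0 (≰⇒> k≮n′))) (>⇒≢ (0<nCk k<n))

-- Subsets of Fin N

subsets : ∀ N → List (Subset N)
subsets zero    = [ [] ]
subsets (suc N) = map (outside ∷_) (subsets N) ++ map (inside ∷_) (subsets N)

∈-subsets : ∀ {N} (S : Subset N) → S ∈ₗ subsets N
∈-subsets []            = Any.here refl
∈-subsets (outside ∷ S) = ∈-++⁺ˡ (∈-map⁺ (outside ∷_) (∈-subsets S))
∈-subsets (inside ∷ S)  = ∈-++⁺ʳ _ (∈-map⁺ (inside ∷_) (∈-subsets S))

subsets! : ∀ N → Unique (subsets N)
subsets! zero    = All.[] ∷ []
subsets! (suc N) =
  Unique.++⁺ (Unique.map⁺ ∷-injectiveʳ (subsets! N)) (Unique.map⁺ ∷-injectiveʳ (subsets! N)) disjoint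
  where
  ∷-injectiveʳ : ∀ {s} {S T : Subset N} → _≡_ {A = Subset (suc N)} (s ∷ S) (s ∷ T) → S ≡ T
  ∷-injectiveʳ refl = refl
  disjoint : ∀ {S} → S ∈ₗ map (outside ∷_) (subsets N) × S ∈ₗ map (inside ∷_) (subsets N) → ⊥
  disjoint (∈out , ∈in) with ∈-map⁻ _ ∈out | ∈-map⁻ _ ∈in
  ... | _ , _ , refl | _ , _ , ()

∑-subsets-suc : ∀ N (f : Subset (suc N) → ℕ) →
  ∑ (subsets (suc N)) f ≡ ∑ (subsets N) (f ∘ (outside ∷_)) + ∑ (subsets N) (f ∘ (inside ∷_))
∑-subsets-suc N f = begin
  sum (map f (map (outside ∷_) (subsets N) ++ map (inside ∷_) (subsets N)))
    ≡⟨ cong sum (map-++ f (map (outside ∷_) (subsets N)) _) ⟩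
  sum (map f (map (outside ∷_) (subsets N)) ++ map f (map (inside ∷_) (subsets N)))
    ≡⟨ sum-++ (map f (map (outside ∷_) (subsets N))) _ ⟩
  sum (map f (map (outside ∷_) (subsets N))) + sum (map f (map (inside ∷_) (subsets N)))
    ≡⟨ cong₂ _+_ (cong sum (map-∘ (subsets N))) (cong sum (map-∘ (subsets N))) ⟨
  ∑ (subsets N) (f ∘ (outside ∷_)) + ∑ (subsets N) (f ∘ (inside ∷_)) ∎
  where open ≡-Reasoning

#subsets-of-size : ∀ N k → ∑ (subsets N) (λ C → ⟦ ∣ C ∣ ≟ k ⟧) ≡ N choose k
#subsets-of-size zero    zero    = refl
#subsets-of-size zero    (suc k) = refl
#subsets-of-size (suc N) zero    =
  trans (∑-subsets-suc N (λ C → ⟦ ∣ C ∣ ≟ 0 ⟧))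
        (cong₂ _+_ (#subsets-of-size N zero) (∑-zero (subsets N) (λ _ → refl)))
#subsets-of-size (suc N) (suc k) =
  trans (∑-subsets-suc N (λ C → ⟦ ∣ C ∣ ≟ suc k ⟧))
    (trans (cong₂ _+_ (#subsets-of-size N (suc k)) (#subsets-of-size N k))
    (trans (+-comm (N choose suc k) (N choose k)) (nCk+nC[k+1]≡[n+1]C[k+1] N k)))

private
  summand : ∀ {N} (S B : Subset N) (α β : ℕ) → Subset N → ℕ
  summand S B α β C = ⟦ S ⊆? C ⟧ * (⟦ ∣ C ∩ (B ─ S) ∣ ≟ α ⟧ * ⟦ ∣ C ─ B ∣ ≟ β ⟧)

#supersets : ∀ {N} {S B : Subset N} → S ⊆ B → ∀ α β →
  ∑ (subsets N) (λ C → ⟦ S ⊆? C ⟧ * (⟦ ∣ C ∩ (B ─ S) ∣ ≟ α ⟧ * ⟦ ∣ C ─ B ∣ ≟ β ⟧))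
    ≡ (∣ B ─ S ∣ choose α) * (∣ ∁ B ∣ choose β)
#supersets {zero} {[]} {[]} _ zero    zero    = refl
#supersets {zero} {[]} {[]} _ zero    (suc β) = refl
#supersets {zero} {[]} {[]} _ (suc α) β       = refl
#supersets {suc N} {inside ∷ S} {inside ∷ B} S⊆B α β =
  trans (∑-subsets-suc N (summand (inside ∷ S) (inside ∷ B) α β))
        (cong₂ _+_ (∑-zero (subsets N) (λ _ → refl)) (#supersets (drop-∷-⊆ S⊆B) α β))
#supersets {suc N} {inside ∷ S} {outside ∷ B} S⊆B = contradiction (S⊆B here) λ ()
#supersets {suc N} {outside ∷ S} {inside ∷ B} S⊆B zero β =
  trans (∑-subsets-suc N (summand (outside ∷ S) (inside ∷ B) zero β))
        (trans (cong₂ _+_ (#supersets (drop-∷-⊆ S⊆B) zero β) (∑-zero (subsets N) (λ {C} _ → *-zeroʳ ⟦ S ⊆? C ⟧)))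
               (+-identityʳ _))
#supersets {suc N} {outside ∷ S} {inside ∷ B} S⊆B (suc α) β =
  trans (∑-subsets-suc N (summand (outside ∷ S) (inside ∷ B) (suc α) β))
        (trans (cong₂ _+_ (#supersets (drop-∷-⊆ S⊆B) (suc α) β) (#supersets (drop-∷-⊆ S⊆B) α β))
               (pascal-*ʳ ∣ B ─ S ∣ α (∣ ∁ B ∣ choose β)))
#supersets {suc N} {outside ∷ S} {outside ∷ B} S⊆B α zero =
  trans (∑-subsets-suc N (summand (outside ∷ S) (outside ∷ B) α zero))
        (trans (cong₂ _+_ (#supersets (drop-∷-⊆ S⊆B) α zero) (∑-zero (subsets N) (λ {C} _ →
                  trans (cong (⟦ S ⊆? C ⟧ *_) (*-zeroʳ ⟦ ∣ C ∩ (B ─ S) ∣ ≟ α ⟧)) (*-zeroʳ ⟦ S ⊆? C ⟧))))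
               (+-identityʳ _))
#supersets {suc N} {outside ∷ S} {outside ∷ B} S⊆B α (suc β) =
  trans (∑-subsets-suc N (summand (outside ∷ S) (outside ∷ B) α (suc β)))
        (trans (cong₂ _+_ (#supersets (drop-∷-⊆ S⊆B) α (suc β)) (#supersets (drop-∷-⊆ S⊆B) α β))
               (pascal-*ˡ (∣ B ─ S ∣ choose α) ∣ ∁ B ∣ β))

∣∣-split : ∀ {N} {S B C : Subset N} → S ⊆ B → S ⊆ C → ∣ C ∣ ≡ ∣ S ∣ + ∣ C ∩ (B ─ S) ∣ + ∣ C ─ B ∣
∣∣-split {S = []} {[]} {[]} _ _ = refl
∣∣-split {S = inside ∷ S} {outside ∷ B} S⊆B _ = contradiction (S⊆B here) λ ()
∣∣-split {S = inside ∷ S} {inside ∷ B} {outside ∷ C} _ S⊆C = contradiction (S⊆C here) λ ()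
∣∣-split {S = inside ∷ S} {inside ∷ B} {inside ∷ C} S⊆B S⊆C =
  cong suc (∣∣-split (drop-∷-⊆ S⊆B) (drop-∷-⊆ S⊆C))
∣∣-split {S = outside ∷ S} {inside ∷ B} {outside ∷ C} S⊆B S⊆C =
  ∣∣-split (drop-∷-⊆ S⊆B) (drop-∷-⊆ S⊆C)
∣∣-split {S = outside ∷ S} {inside ∷ B} {inside ∷ C} S⊆B S⊆C =
  trans (cong suc (∣∣-split (drop-∷-⊆ S⊆B) (drop-∷-⊆ S⊆C)))
        (cong (_+ ∣ C ─ B ∣) (sym (+-suc ∣ S ∣ _)))
∣∣-split {S = outside ∷ S} {outside ∷ B} {outside ∷ C} S⊆B S⊆C =
  ∣∣-split (drop-∷-⊆ S⊆B) (drop-∷-⊆ S⊆C)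
∣∣-split {S = outside ∷ S} {outside ∷ B} {inside ∷ C} S⊆B S⊆C =
  trans (cong suc (∣∣-split (drop-∷-⊆ S⊆B) (drop-∷-⊆ S⊆C))) (sym (+-suc (∣ S ∣ + _) _))

∣p∣≡∣q∣+∣p─q∣ : ∀ {N} {p q : Subset N} → q ⊆ p → ∣ p ∣ ≡ ∣ q ∣ + ∣ p ─ q ∣
∣p∣≡∣q∣+∣p─q∣ {p = []}          {[]}          _   = refl
∣p∣≡∣q∣+∣p─q∣ {p = outside ∷ p} {inside ∷ q}  q⊆p = contradiction (q⊆p here) λ ()
∣p∣≡∣q∣+∣p─q∣ {p = inside ∷ p}  {inside ∷ q}  q⊆p = cong suc (∣p∣≡∣q∣+∣p─q∣ (drop-∷-⊆ q⊆p))
∣p∣≡∣q∣+∣p─q∣ {p = inside ∷ p}  {outside ∷ q} q⊆p =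
  trans (cong suc (∣p∣≡∣q∣+∣p─q∣ (drop-∷-⊆ q⊆p))) (sym (+-suc ∣ q ∣ _))
∣p∣≡∣q∣+∣p─q∣ {p = outside ∷ p} {outside ∷ q} q⊆p = ∣p∣≡∣q∣+∣p─q∣ (drop-∷-⊆ q⊆p)

elements↔Fin∣∣ : ∀ {N} (S : Subset N) → Σ (Fin N) (_∈ S) ↔ Fin ∣ S ∣
elements↔Fin∣∣ []            = mk↔ₛ′ (λ ()) (λ ()) (λ ()) (λ ())
elements↔Fin∣∣ (outside ∷ S) = mk↔ₛ′ to from (Inverse.strictlyInverseˡ e) from-to
  where
  e = elements↔Fin∣∣ S
  to : Σ (Fin _) (_∈ outside ∷ S) → Fin ∣ S ∣
  to (suc x , there x∈S) = Inverse.to e (x , x∈S)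
  from : Fin ∣ S ∣ → Σ (Fin _) (_∈ outside ∷ S)
  from i with x , x∈S ← Inverse.from e i = suc x , there x∈S
  from-to : ∀ x → from (to x) ≡ x
  from-to (suc x , there x∈S) rewrite Inverse.strictlyInverseʳ e (x , x∈S) = refl
elements↔Fin∣∣ (inside ∷ S)  = mk↔ₛ′ to from to-from from-to
  where
  e = elements↔Fin∣∣ S
  to : Σ (Fin _) (_∈ inside ∷ S) → Fin (suc ∣ S ∣)
  to (zero  , here)         = zero
  to (suc x , there x∈S)    = suc (Inverse.to e (x , x∈S))
  from : Fin (suc ∣ S ∣) → Σ (Fin _) (_∈ inside ∷ S)
  from zero    = zero , here
  from (suc i) with x , x∈S ← Inverse.from e i = suc x , there x∈S
  to-from : ∀ i → to (from i) ≡ i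
  to-from zero    = refl
  to-from (suc i) = cong suc (Inverse.strictlyInverseˡ e i)
  from-to : ∀ x → from (to x) ≡ x
  from-to (zero  , here)      = refl
  from-to (suc x , there x∈S) rewrite Inverse.strictlyInverseʳ e (x , x∈S) = refl

∣∣-cong-↔ : ∀ {M N} {S : Subset M} {T : Subset N} → Σ (Fin M) (_∈ S) ↔ Σ (Fin N) (_∈ T) → ∣ S ∣ ≡ ∣ T ∣
∣∣-cong-↔ {S = S} {T} S↔T =
  ↔⇒≡ (↔-trans (↔-sym (elements↔Fin∣∣ S)) (↔-trans S↔T (elements↔Fin∣∣ T)))

∣∣≡0⇒∉ : ∀ {N} {T : Subset N} → ∣ T ∣ ≡ 0 → ∀ {x} → x ∉ T
∣∣≡0⇒∉ {T = T} ∣T∣≡0 {x} x∈T with Inverse.to (elements↔Fin∣∣ T) (x , x∈T)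
... | i rewrite ∣T∣≡0 = ¬Fin0 i

∉⇒∣∣≡0 : ∀ {N} {T : Subset N} → (∀ {x} → x ∉ T) → ∣ T ∣ ≡ 0
∉⇒∣∣≡0 {N} ∉T = trans (cong ∣_∣ (Empty-unique (λ (_ , x∈T) → ∉T x∈T))) (∣⊥∣≡0 N)

-- Balls and boundaries

∈⇔T-lookup : ∀ {N} {S : Subset N} {v} → v ∈ S ⇔ T (lookup S v)
∈⇔T-lookup {S = S} {v} = mk⇔ (Equivalence.from T-≡ ∘ []=⇒lookup) (lookup⇒[]= v S ∘ Equivalence.to T-≡)

∈-─⁻ : ∀ {N} (p q : Subset N) {x} → x ∈ p ─ q → x ∈ p × x ∉ q
∈-─⁻ (s ∷ p) (outside ∷ q) here          = here , λ ()
∈-─⁻ (s ∷ p) (t ∷ q)       (there x∈p─q) = Product.map there (_∘ drop-there) (∈-─⁻ p q x∈p─q)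

T-anyFin : ∀ {m} (f : Fin m → Bool) → T (anyFin f) ⇔ ∃ λ u → T (f u)
T-anyFin {zero}  f = mk⇔ (λ ()) (λ ())
T-anyFin {suc m} f = mk⇔ to from
  where
  to : T (anyFin f) → ∃ λ u → T (f u)
  to t with Equivalence.to (T-∨ {f zero}) t
  ... | inj₁ t₀ = zero , t₀
  ... | inj₂ tₛ with u , t ← Equivalence.to (T-anyFin (f ∘ suc)) tₛ = suc u , t
  from : (∃ λ u → T (f u)) → T (anyFin f)
  from (zero  , t) = Equivalence.from (T-∨ {f zero}) (inj₁ t)
  from (suc u , t) = Equivalence.from (T-∨ {f zero}) (inj₂ (Equivalence.from (T-anyFin (f ∘ suc)) (u , t)))

Adjacent : (X : Graph) → Fin (n X) → Fin (n X) → Set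
Adjacent X u v = adj X u v ≡ true

∈-ball1⇔ : ∀ (X : Graph) (S : Subset (n X)) {v} → v ∈ ball1 X S ⇔ (v ∈ S ⊎ ∃[ u ] u ∈ S × Adjacent X u v)
∈-ball1⇔ X S {v} = mk⇔ to from
  where
  lookup-ball1 = lookup∘tabulate (λ v → lookup S v ∨ anyFin (λ u → lookup S u ∧ adj X u v)) v
  to : v ∈ ball1 X S → v ∈ S ⊎ ∃[ u ] u ∈ S × Adjacent X u v
  to v∈B with Equivalence.to T-∨ (subst T lookup-ball1 (Equivalence.to ∈⇔T-lookup v∈B))
  ... | inj₁ v∈S = inj₁ (Equivalence.from ∈⇔T-lookup v∈S)
  ... | inj₂ t with u , t′ ← Equivalence.to (T-anyFin _) t with u∈S , uv ← Equivalence.to T-∧ t′ =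
    inj₂ (u , Equivalence.from ∈⇔T-lookup u∈S , Equivalence.to T-≡ uv)
  from : v ∈ S ⊎ ∃[ u ] u ∈ S × Adjacent X u v → v ∈ ball1 X S
  from = Equivalence.from ∈⇔T-lookup ∘ subst T (sym lookup-ball1) ∘ Equivalence.from T-∨
       ∘ Sum.map (Equivalence.to ∈⇔T-lookup) neighbour
    where
    neighbour : ∃[ u ] u ∈ S × Adjacent X u v → T (anyFin (λ u → lookup S u ∧ adj X u v))
    neighbour (u , u∈S , uv) = Equivalence.from (T-anyFin _)
      (u , Equivalence.from T-∧ (Equivalence.to ∈⇔T-lookup u∈S , Equivalence.from T-≡ uv))

∂ : (X : Graph) → Subset (n X) → Subset (n X)
∂ X S = ball1 X S ─ S

∈-∂⇔ : ∀ (X : Graph) (S : Subset (n X)) {v} → v ∈ ∂ X S ⇔ (v ∉ S × ∃[ u ] u ∈ S × Adjacent X u v)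
∈-∂⇔ X S {v} = mk⇔ to from
  where
  to : v ∈ ∂ X S → v ∉ S × ∃[ u ] u ∈ S × Adjacent X u v
  to v∈∂ with v∈B , v∉S ← ∈-─⁻ (ball1 X S) S v∈∂ with Equivalence.to (∈-ball1⇔ X S) v∈B
  ... | inj₁ v∈S = contradiction v∈S v∉S
  ... | inj₂ N   = v∉S , N
  from : v ∉ S × ∃[ u ] u ∈ S × Adjacent X u v → v ∈ ∂ X S
  from (v∉S , N) = x∈p∧x∉q⇒x∈p─q (Equivalence.from (∈-ball1⇔ X S) (inj₂ N)) v∉S

S⊆ball1 : ∀ (X : Graph) (S : Subset (n X)) → S ⊆ ball1 X S
S⊆ball1 X S = Equivalence.from (∈-ball1⇔ X S) ∘ inj₁

∣ball1∣≡∣S∣+∣∂∣ : ∀ (X : Graph) (S : Subset (n X)) → ∣ ball1 X S ∣ ≡ ∣ S ∣ + ∣ ∂ X S ∣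
∣ball1∣≡∣S∣+∣∂∣ X S = ∣p∣≡∣q∣+∣p─q∣ (S⊆ball1 X S)

Closed : (X : Graph) → Subset (n X) → Set
Closed X S = ∀ u v → u ∈ S → Adjacent X u v → v ∈ S

closed⇔∣∂∣≡0 : ∀ (X : Graph) (S : Subset (n X)) → Closed X S ⇔ ∣ ∂ X S ∣ ≡ 0
closed⇔∣∂∣≡0 X S = mk⇔ to from
  where
  to : Closed X S → ∣ ∂ X S ∣ ≡ 0
  to closed = ∉⇒∣∣≡0 λ v∈∂ →
    let v∉S , u , u∈S , uv = Equivalence.to (∈-∂⇔ X S) v∈∂ in v∉S (closed u _ u∈S uv)
  from : ∣ ∂ X S ∣ ≡ 0 → Closed X S
  from ∣∂∣≡0 u v u∈S uv with v ∈? S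
  ... | yes v∈S = v∈S
  ... | no  v∉S = contradiction (Equivalence.from (∈-∂⇔ X S) (v∉S , u , u∈S , uv)) (∣∣≡0⇒∉ ∣∂∣≡0)

-- Isomorphisms between induced subgraphs

VSub-≡ : ∀ {X : Graph} {S : Subset (n X)} {x y : VSub X S} → proj₁ x ≡ proj₁ y → x ≡ y
VSub-≡ {x = v , p} {.v , q} refl = cong (v ,_) ([]=-irrelevant p q)

module _ {X Y : Graph} {C : Subset (n X)} {D : Subset (n Y)} where

  Iso-sym : Iso X C Y D → Iso Y D X C
  Iso-sym φ = record { bij = ↔-sym (Iso.bij φ) ; pres = pres }
    where
    open Inverse (Iso.bij φ)
    pres : ∀ x y → adj Y (proj₁ x) (proj₁ y) ≡ adj X (proj₁ (from x)) (proj₁ (from y))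
    pres x y = sym (trans (Iso.pres φ (from x) (from y))
                          (cong₂ (λ x y → adj Y (proj₁ x) (proj₁ y)) (strictlyInverseˡ x) (strictlyInverseˡ y)))

  Iso-trans : ∀ {Z : Graph} {E : Subset (n Z)} → Iso X C Y D → Iso Y D Z E → Iso X C Z E
  Iso-trans φ ψ = record
    { bij  = ↔-trans (Iso.bij φ) (Iso.bij ψ)
    ; pres = λ x y → trans (Iso.pres φ x y) (Iso.pres ψ _ _) }

  module IsoImage (φ : Iso X C Y D) where
    open Inverse (Iso.bij φ)

    ⇑ : ∀ {v} → v ∈ C → Fin (n Y)
    ⇑ {v} v∈C = proj₁ (to (v , v∈C))

    ⇑∈ : ∀ {v} (v∈C : v ∈ C) → ⇑ v∈C ∈ D
    ⇑∈ {v} v∈C = proj₂ (to (v , v∈C))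

    ⇓ : ∀ {w} → w ∈ D → Fin (n X)
    ⇓ {w} w∈D = proj₁ (from (w , w∈D))

    ⇓∈ : ∀ {w} (w∈D : w ∈ D) → ⇓ w∈D ∈ C
    ⇓∈ {w} w∈D = proj₂ (from (w , w∈D))

    ⇓⇑ : ∀ {v} (v∈C : v ∈ C) (⇑v∈D : ⇑ v∈C ∈ D) → ⇓ ⇑v∈D ≡ v
    ⇓⇑ {v} v∈C ⇑v∈D = cong proj₁ (trans (cong from (VSub-≡ {Y} refl)) (strictlyInverseʳ (v , v∈C)))

    ⇑⇓ : ∀ {w} (w∈D : w ∈ D) (⇓w∈C : ⇓ w∈D ∈ C) → ⇑ ⇓w∈C ≡ w
    ⇑⇓ {w} w∈D ⇓w∈C = cong proj₁ (trans (cong to (VSub-≡ {X} refl)) (strictlyInverseˡ (w , w∈D)))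

    ⇑-cong : ∀ {u v} → u ≡ v → (u∈C : u ∈ C) (v∈C : v ∈ C) → ⇑ u∈C ≡ ⇑ v∈C
    ⇑-cong refl u∈C v∈C = cong ⇑ ([]=-irrelevant u∈C v∈C)

    ⇑-adj : ∀ {u v} (u∈C : u ∈ C) (v∈C : v ∈ C) → adj X u v ≡ adj Y (⇑ u∈C) (⇑ v∈C)
    ⇑-adj {u} {v} u∈C v∈C = Iso.pres φ (u , u∈C) (v , v∈C)

    private
      imageSide : Subset (n X) → (w : Fin (n Y)) → Dec (w ∈ D) → Bool
      imageSide S w (yes w∈D) = lookup S (⇓ w∈D)
      imageSide S w (no _)    = false

    image : Subset (n X) → Subset (n Y)
    image S = tabulate (λ w → imageSide S w (w ∈? D))

    ∈-image⇔ : ∀ {S w} → w ∈ image S ⇔ Σ (w ∈ D) (λ w∈D → ⇓ w∈D ∈ S)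
    ∈-image⇔ {S} {w} = mk⇔
      (λ w∈ → T-side⇒ (w ∈? D) (subst T (lookup∘tabulate _ w) (Equivalence.to ∈⇔T-lookup w∈)))
      (λ (w∈D , ⇓w∈S) →
        Equivalence.from ∈⇔T-lookup (subst T (sym (lookup∘tabulate _ w)) (⇒T-side (w ∈? D) w∈D ⇓w∈S)))
      where
      T-side⇒ : (d : Dec (w ∈ D)) → T (imageSide S w d) → Σ (w ∈ D) (λ w∈D → ⇓ w∈D ∈ S)
      T-side⇒ (yes w∈D) t = w∈D , Equivalence.from ∈⇔T-lookup t
      ⇒T-side : (d : Dec (w ∈ D)) (w∈D : w ∈ D) → ⇓ w∈D ∈ S → T (imageSide S w d)
      ⇒T-side (yes w∈D′) w∈D ⇓w∈S rewrite []=-irrelevant w∈D′ w∈D = Equivalence.to ∈⇔T-lookup ⇓w∈S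
      ⇒T-side (no w∉D)   w∈D _ = contradiction w∈D w∉D

    image⊆ : ∀ {S} → image S ⊆ D
    image⊆ = proj₁ ∘ Equivalence.to ∈-image⇔

    ⇑∈image⇔ : ∀ {S v} (v∈C : v ∈ C) → ⇑ v∈C ∈ image S ⇔ v ∈ S
    ⇑∈image⇔ {S} v∈C = mk⇔
      (λ ⇑v∈ → let ⇑v∈D , ⇓⇑v∈S = Equivalence.to ∈-image⇔ ⇑v∈ in
        subst (_∈ S) (⇓⇑ v∈C ⇑v∈D) ⇓⇑v∈S)
      (λ v∈S → Equivalence.from ∈-image⇔ (⇑∈ v∈C , subst (_∈ S) (sym (⇓⇑ v∈C (⇑∈ v∈C))) v∈S))

    restrict : ∀ {S} → S ⊆ C → Iso X S Y (image S)
    restrict {S} S⊆C = record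
      { bij  = mk↔ₛ′ to′ from′ to∘from from∘to
      ; pres = λ (u , u∈S) (v , v∈S) → ⇑-adj (S⊆C u∈S) (S⊆C v∈S) }
      where
      to′ : VSub X S → VSub Y (image S)
      to′ (v , v∈S) = ⇑ (S⊆C v∈S) , Equivalence.from (⇑∈image⇔ (S⊆C v∈S)) v∈S
      from′ : VSub Y (image S) → VSub X S
      from′ (w , w∈) = ⇓ (image⊆ w∈) , proj₂ (Equivalence.to ∈-image⇔ w∈)
      to∘from : ∀ y → to′ (from′ y) ≡ y
      to∘from (w , w∈) = VSub-≡ {Y} (⇑⇓ (image⊆ w∈) _)
      from∘to : ∀ x → from′ (to′ x) ≡ x
      from∘to (v , v∈S) = VSub-≡ {X} (⇓⇑ (S⊆C v∈S) _)

module _ {X Y : Graph} {C : Subset (n X)} {D : Subset (n Y)} (φ : Iso X C Y D) where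
  private
    module φ   = IsoImage φ
    module φ⁻¹ = IsoImage (Iso-sym φ)

  image-inverseˡ : ∀ {S} → S ⊆ C → φ⁻¹.image (φ.image S) ≡ S
  image-inverseˡ {S} S⊆C = ⊆-antisym
    (λ v∈ → let v∈C , ⇑v∈ = Equivalence.to φ⁻¹.∈-image⇔ v∈ in Equivalence.to (φ.⇑∈image⇔ v∈C) ⇑v∈)
    (λ v∈S → Equivalence.from φ⁻¹.∈-image⇔ (S⊆C v∈S , Equivalence.from (φ.⇑∈image⇔ (S⊆C v∈S)) v∈S))

  image-inverseʳ : ∀ {T} → T ⊆ D → φ.image (φ⁻¹.image T) ≡ T
  image-inverseʳ {T} T⊆D = ⊆-antisym
    (λ w∈ → let w∈D , ⇓w∈ = Equivalence.to φ.∈-image⇔ w∈ in Equivalence.to (φ⁻¹.⇑∈image⇔ w∈D) ⇓w∈)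
    (λ w∈T → Equivalence.from φ.∈-image⇔ (T⊆D w∈T , Equivalence.from (φ⁻¹.⇑∈image⇔ (T⊆D w∈T)) w∈T))

  image-∂ : ∀ {S} → S ⊆ C → φ.image (C ∩ ∂ X S) ≡ D ∩ ∂ Y (φ.image S)
  image-∂ {S} S⊆C = ⊆-antisym into onto
    where
    into : φ.image (C ∩ ∂ X S) ⊆ D ∩ ∂ Y (φ.image S)
    into {w} w∈ with w∈D , ⇓w∈ ← Equivalence.to φ.∈-image⇔ w∈
      with ⇓w∈C , ⇓w∈∂ ← x∈p∩q⁻ C _ ⇓w∈
      with ⇓w∉S , u , u∈S , adj-u⇓w ← Equivalence.to (∈-∂⇔ X S) ⇓w∈∂ =
      x∈p∩q⁺ (w∈D , Equivalence.from (∈-∂⇔ Y (φ.image S)) (w∉image , φ.⇑ (S⊆C u∈S) , ⇑u∈image , adj-⇑u-w))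
      where
      w∉image : w ∉ φ.image S
      w∉image w∈image =
        ⇓w∉S (subst (_∈ S) (cong φ.⇓ ([]=-irrelevant _ w∈D)) (proj₂ (Equivalence.to φ.∈-image⇔ w∈image)))
      ⇑u∈image : φ.⇑ (S⊆C u∈S) ∈ φ.image S
      ⇑u∈image = Equivalence.from (φ.⇑∈image⇔ (S⊆C u∈S)) u∈S
      adj-⇑u-w : Adjacent Y (φ.⇑ (S⊆C u∈S)) w
      adj-⇑u-w = trans (cong (adj Y _) (sym (φ.⇑⇓ w∈D ⇓w∈C))) (trans (sym (φ.⇑-adj (S⊆C u∈S) ⇓w∈C)) adj-u⇓w)
    onto : D ∩ ∂ Y (φ.image S) ⊆ φ.image (C ∩ ∂ X S)
    onto {w} w∈ with w∈D , w∈∂ ← x∈p∩q⁻ D _ w∈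
      with w∉image , u′ , u′∈image , adj-u′w ← Equivalence.to (∈-∂⇔ Y (φ.image S)) w∈∂ =
      Equivalence.from φ.∈-image⇔ (w∈D , x∈p∩q⁺ (φ.⇓∈ w∈D ,
        Equivalence.from (∈-∂⇔ X S) (⇓w∉S , φ.⇓ u′∈D , ⇓u′∈S , adj-⇓u′-⇓w)))
      where
      u′∈D = φ.image⊆ u′∈image
      ⇓u′∈S : φ.⇓ u′∈D ∈ S
      ⇓u′∈S = proj₂ (Equivalence.to φ.∈-image⇔ u′∈image)
      ⇓w∉S : φ.⇓ w∈D ∉ S
      ⇓w∉S ⇓w∈S = w∉image (Equivalence.from φ.∈-image⇔ (w∈D , ⇓w∈S))
      adj-⇓u′-⇓w : Adjacent X (φ.⇓ u′∈D) (φ.⇓ w∈D)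
      adj-⇓u′-⇓w = trans (φ.⇑-adj (φ.⇓∈ u′∈D) (φ.⇓∈ w∈D))
                         (trans (cong₂ (adj Y) (φ.⇑⇓ u′∈D _) (φ.⇑⇓ w∈D _)) adj-u′w)

ConnectedIn : (X : Graph) → Subset (n X) → Set
ConnectedIn X S = ∀ u v → u ∈ S → v ∈ S → WalkIn X S u v

walk-start : ∀ {X : Graph} {S : Subset (n X)} {u v} → WalkIn X S u v → u ∈ S
walk-start (here u∈S)     = u∈S
walk-start (step u∈S _ _) = u∈S

module _ {X Y : Graph} {S : Subset (n X)} {T : Subset (n Y)} (φ : Iso X S Y T) where
  open IsoImage φ

  walk-Iso : ∀ {u v} → WalkIn X S u v → (u∈S : u ∈ S) (v∈S : v ∈ S) → WalkIn Y T (⇑ u∈S) (⇑ v∈S)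
  walk-Iso (here _) u∈S v∈S = subst (WalkIn Y T (⇑ u∈S)) (⇑-cong refl u∈S v∈S) (here (⇑∈ u∈S))
  walk-Iso (step _ uw walk) u∈S v∈S =
    step (⇑∈ u∈S) (trans (sym (⇑-adj u∈S (walk-start walk))) uw) (walk-Iso walk (walk-start walk) v∈S)

  connectedIn-Iso : ConnectedIn X S → ConnectedIn Y T
  connectedIn-Iso connected u v u∈T v∈T =
    subst₂ (WalkIn Y T) (⇑⇓ u∈T (⇓∈ u∈T)) (⇑⇓ v∈T (⇓∈ v∈T))
           (walk-Iso (connected _ _ (⇓∈ u∈T) (⇓∈ v∈T)) (⇓∈ u∈T) (⇓∈ v∈T))

  nonempty-Iso : Nonempty S → Nonempty T
  nonempty-Iso (v , v∈S) = ⇑ v∈S , ⇑∈ v∈S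

Connected : Graph → Set
Connected H = Nonempty {n H} ⊤ × ConnectedIn H ⊤

-- Deciding copies

∃-Vector? : ∀ {k} m {P : Vector (Fin k) m → Set} →
  (∀ {f g} → f ≗ g → P f → P g) → (∀ f → Dec (P f)) → Dec (∃ P)
∃-Vector? zero    resp P? = map′ (_ ,_) (λ (f , Pf) → resp (λ ()) Pf) (P? (λ ()))
∃-Vector? (suc m) resp P? = map′
  (λ (x , f , Px∷f) → x ∷ᶠ f , Px∷f)
  (λ (f , Pf) → f zero , f ∘ suc , resp (λ { zero → refl ; (suc i) → refl }) Pf)
  (any? λ x → ∃-Vector? m (λ f≗g → resp (λ { zero → refl ; (suc i) → f≗g i })) (λ f → P? (x ∷ᶠ f)))

module _ (X : Graph) (S : Subset (n X)) (H : Graph) where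

  IsCopyMap : Vector (Fin (n X)) (n H) → Set
  IsCopyMap g = (∀ a b → g a ≡ g b → a ≡ b) × (∀ a → g a ∈ S) ×
                (∀ v → v ∈ S → ∃ λ a → g a ≡ v) × (∀ a b → adj H a b ≡ adj X (g a) (g b))

  isCopyMap? : ∀ g → Dec (IsCopyMap g)
  isCopyMap? g = all? (λ a → all? λ b → (g a ≟ᶠ g b) →-dec (a ≟ᶠ b))
          ×-dec all? (λ a → g a ∈? S)
          ×-dec all? (λ v → (v ∈? S) →-dec any? λ a → g a ≟ᶠ v)
          ×-dec all? (λ a → all? λ b → adj H a b ≟ᵇ adj X (g a) (g b))

  IsCopyMap-resp-≗ : ∀ {f g} → f ≗ g → IsCopyMap f → IsCopyMap g
  IsCopyMap-resp-≗ f≗g (injective , into , onto , adjacency) =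
    (λ a b ga≡gb → injective a b (trans (f≗g a) (trans ga≡gb (sym (f≗g b))))) ,
    (λ a → subst (_∈ S) (f≗g a) (into a)) ,
    (λ v v∈S → let a , fa≡v = onto v v∈S in a , trans (sym (f≗g a)) fa≡v) ,
    (λ a b → trans (adjacency a b) (cong₂ (adj X) (f≗g a) (f≗g b)))

  copy⇔∃copyMap : X [ S ]≅ H ⇔ ∃ IsCopyMap
  copy⇔∃copyMap = mk⇔ to from
    where
    to : X [ S ]≅ H → ∃ IsCopyMap
    to ψ = g , injective , (λ a → ⇓∈ ∈⊤) , (λ v v∈S → ⇑ v∈S , ⇓⇑ v∈S ∈⊤) , adjacency
      where
      open IsoImage ψ
      g : Vector (Fin (n X)) (n H)
      g a = ⇓ (∈⊤ {x = a})
      injective : ∀ a b → g a ≡ g b → a ≡ b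
      injective a b ga≡gb =
        trans (sym (⇑⇓ ∈⊤ (⇓∈ ∈⊤))) (trans (⇑-cong ga≡gb (⇓∈ ∈⊤) (⇓∈ ∈⊤)) (⇑⇓ ∈⊤ (⇓∈ ∈⊤)))
      adjacency : ∀ a b → adj H a b ≡ adj X (g a) (g b)
      adjacency a b =
        sym (trans (⇑-adj (⇓∈ ∈⊤) (⇓∈ ∈⊤)) (cong₂ (adj H) (⇑⇓ ∈⊤ (⇓∈ ∈⊤)) (⇑⇓ ∈⊤ (⇓∈ ∈⊤))))
    from : ∃ IsCopyMap → X [ S ]≅ H
    from (g , injective , into , onto , adjacency) = record
      { bij  = mk↔ₛ′ (λ (v , v∈S) → proj₁ (onto v v∈S) , ∈⊤) (λ (a , _) → g a , into a)
                     (λ (a , _) → VSub-≡ {H} (injective _ _ (proj₂ (onto (g a) (into a)))))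
                     (λ (v , v∈S) → VSub-≡ {X} (proj₂ (onto v v∈S)))
      ; pres = λ (u , u∈S) (v , v∈S) →
          sym (trans (adjacency _ _) (cong₂ (adj X) (proj₂ (onto u u∈S)) (proj₂ (onto v v∈S)))) }

_[_]≅?_ : (X : Graph) (S : Subset (n X)) (H : Graph) → Dec (X [ S ]≅ H)
X [ S ]≅? H = map′ (Equivalence.from (copy⇔∃copyMap X S H)) (Equivalence.to (copy⇔∃copyMap X S H))
                   (∃-Vector? (n H) (IsCopyMap-resp-≗ X S H) (isCopyMap? X S H))

-- Decks

ℓ-subsets : ℕ → ∀ N → List (Subset N)
ℓ-subsets ℓ N = filter (λ C → ∣ C ∣ ≟ ℓ) (subsets N)

module _ {ℓ : ℕ} where
  private
    Card : ℕ → Set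
    Card N = Σ (Subset N) (λ C → ∣ C ∣ ≡ ℓ)

    extend : ∀ {N N′} → (Card N → Card N′) → Subset N → Subset N′
    extend f C with ∣ C ∣ ≟ ℓ
    ... | yes ∣C∣≡ℓ = proj₁ (f (C , ∣C∣≡ℓ))
    ... | no  _     = ∅

    extend-≡ : ∀ {N N′} (f : Card N → Card N′) (c : Card N) → extend f (proj₁ c) ≡ proj₁ (f c)
    extend-≡ f (C , ∣C∣≡ℓ) with ∣ C ∣ ≟ ℓ
    ... | yes ∣C∣≡ℓ′ = cong (λ p → proj₁ (f (C , p))) (≡-irrelevant ∣C∣≡ℓ′ ∣C∣≡ℓ)
    ... | no  ∣C∣≢ℓ  = contradiction ∣C∣≡ℓ ∣C∣≢ℓ

    card : ∀ {N C} → C ∈ₗ ℓ-subsets ℓ N → Card N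
    card {N} {C} C∈ = C , proj₂ (∈-filter⁻ (λ C → ∣ C ∣ ≟ ℓ) {xs = subsets N} C∈)

    extend∈ : ∀ {N N′} (f : Card N → Card N′) {C} → C ∈ₗ ℓ-subsets ℓ N → extend f C ∈ₗ ℓ-subsets ℓ N′
    extend∈ f C∈ with D , ∣D∣≡ℓ ← f (card C∈) in fC≡D =
      subst (_∈ₗ ℓ-subsets ℓ _) (sym (trans (extend-≡ f (card C∈)) (cong proj₁ fC≡D)))
            (∈-filter⁺ (λ C → ∣ C ∣ ≟ ℓ) (∈-subsets D) ∣D∣≡ℓ)

    extend-inverse : ∀ {N N′} (f : Card N → Card N′) (g : Card N′ → Card N) →
      (∀ c → g (f c) ≡ c) → ∀ {C} → C ∈ₗ ℓ-subsets ℓ N → extend g (extend f C) ≡ C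
    extend-inverse f g g∘f C∈ =
      trans (cong (extend g) (extend-≡ f (card C∈)))
            (trans (extend-≡ g (f (card C∈))) (cong proj₁ (g∘f (card C∈))))

  ∑-cards-deck : ∀ {G G′ : Graph} → SameDeck ℓ G G′ →
    (w : Subset (n G) → ℕ) (w′ : Subset (n G′) → ℕ) →
    (∀ {C D} → Iso G C G′ D → w′ D ≡ w C) → ∑ (ℓ-subsets ℓ (n G)) w ≡ ∑ (ℓ-subsets ℓ (n G′)) w′
  ∑-cards-deck {G} {G′} (deck , isomorphic) w w′ w′≡w = ∑-reindex
    (Unique.filter⁺ _ (subsets! (n G))) (Unique.filter⁺ _ (subsets! (n G′)))
    (extend to) (extend from) (extend∈ to) (extend∈ from)
    (extend-inverse to from strictlyInverseʳ) (extend-inverse from to strictlyInverseˡ)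
    w w′ (λ C∈ → trans (cong w′ (extend-≡ to (card C∈))) (w′≡w (isomorphic (card C∈))))
    where open Inverse deck

#ℓ-subsets : ∀ ℓ N → ∑ (ℓ-subsets ℓ N) (λ _ → 1) ≡ N choose ℓ
#ℓ-subsets ℓ N = trans (∑-filter (λ C → ∣ C ∣ ≟ ℓ) (subsets N) (λ _ → 1))
                       (trans (∑-cong (subsets N) (λ {C} _ → *-identityʳ ⟦ ∣ C ∣ ≟ ℓ ⟧)) (#subsets-of-size N ℓ))

deck-order : ∀ {ℓ} {G G′ : Graph} → 0 < ℓ → ℓ ≤ n G → SameDeck ℓ G G′ → n G ≡ n G′
deck-order {ℓ} {G} {G′} 0<ℓ ℓ≤n deck = C-injectiveˡ 0<ℓ ℓ≤n
  (trans (sym (#ℓ-subsets ℓ (n G)))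
         (trans (∑-cards-deck deck (λ _ → 1) (λ _ → 1) (λ _ → refl)) (#ℓ-subsets ℓ (n G′))))

-- Counting copies of H

module CopiesOf (H : Graph) where

  ∣copy∣ : ∀ {X : Graph} {S : Subset (n X)} → X [ S ]≅ H → ∣ S ∣ ≡ n H
  ∣copy∣ ψ = trans (∣∣-cong-↔ (Iso.bij ψ)) (∣⊤∣≡n (n H))

  ∣ball1∣-copy : ∀ {X : Graph} {S : Subset (n X)} → X [ S ]≅ H → ∣ ball1 X S ∣ ≡ n H + ∣ ∂ X S ∣
  ∣ball1∣-copy {X} {S} ψ = trans (∣ball1∣≡∣S∣+∣∂∣ X S) (cong (_+ ∣ ∂ X S ∣) (∣copy∣ ψ))

  subsetsOf : ∀ {N} → Subset N → List (Subset N)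
  subsetsOf C = filter (_⊆? C) (subsets _)

  copiesMeeting∂ : (X : Graph) → Subset (n X) → ℕ → ℕ
  copiesMeeting∂ X C i = ∑ (subsetsOf C) (λ S → ⟦ X [ S ]≅? H ⟧ * ⟦ ∣ C ∩ ∂ X S ∣ ≟ i ⟧)

  module _ {X Y : Graph} {C : Subset (n X)} {D : Subset (n Y)} (φ : Iso X C Y D) where
    private
      module φ   = IsoImage φ
      module φ⁻¹ = IsoImage (Iso-sym φ)

    copy-image⇔ : ∀ {S} → S ⊆ C → X [ S ]≅ H ⇔ Y [ φ.image S ]≅ H
    copy-image⇔ S⊆C = mk⇔ (Iso-trans (Iso-sym (φ.restrict S⊆C))) (Iso-trans (φ.restrict S⊆C))

    ∣∩∂∣-image : ∀ {S} → S ⊆ C → ∣ C ∩ ∂ X S ∣ ≡ ∣ D ∩ ∂ Y (φ.image S) ∣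
    ∣∩∂∣-image {S} S⊆C =
      trans (∣∣-cong-↔ (Iso.bij (φ.restrict (p∩q⊆p C (∂ X S))))) (cong ∣_∣ (image-∂ φ S⊆C))

    copiesMeeting∂-Iso : ∀ i → copiesMeeting∂ Y D i ≡ copiesMeeting∂ X C i
    copiesMeeting∂-Iso i = sym (∑-reindex
      (Unique.filter⁺ _ (subsets! (n X))) (Unique.filter⁺ _ (subsets! (n Y))) φ.image φ⁻¹.image
      (λ _ → ∈-filter⁺ (_⊆? D) (∈-subsets _) φ.image⊆)
      (λ _ → ∈-filter⁺ (_⊆? C) (∈-subsets _) φ⁻¹.image⊆)
      (λ S∈ → image-inverseˡ φ (⊆Of S∈))
      (λ T∈ → image-inverseʳ φ (⊆Of T∈))
      _ _
      (λ {S} S∈ → cong₂ _*_ (sym (⟦⟧-cong (copy-image⇔ (⊆Of S∈)) (X [ S ]≅? H) (Y [ φ.image S ]≅? H)))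
                            (cong (λ k → ⟦ k ≟ i ⟧) (sym (∣∩∂∣-image (⊆Of S∈))))))
      where
      ⊆Of : ∀ {N} {A S : Subset N} → S ∈ₗ subsetsOf A → S ⊆ A
      ⊆Of {A = A} S∈ = proj₂ (∈-filter⁻ (_⊆? A) {xs = subsets _} S∈)

  deckCount : ℕ → (X : Graph) → ℕ → ℕ
  deckCount ℓ X i = ∑ (ℓ-subsets ℓ (n X)) (λ C → copiesMeeting∂ X C i)

  deckCount-deck : ∀ {ℓ} {G G′ : Graph} → SameDeck ℓ G G′ → ∀ i → deckCount ℓ G i ≡ deckCount ℓ G′ i
  deckCount-deck deck i = ∑-cards-deck deck _ _ (λ φ → copiesMeeting∂-Iso φ i)

  card⊇copy⇔ : ∀ ℓ (X : Graph) {i} → n H + i ≤ ℓ → ∀ S C →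
    (∣ C ∣ ≡ ℓ × S ⊆ C × X [ S ]≅ H × ∣ C ∩ ∂ X S ∣ ≡ i) ⇔
    (X [ S ]≅ H × S ⊆ C × ∣ C ∩ ∂ X S ∣ ≡ i × ∣ C ─ ball1 X S ∣ ≡ ℓ ∸ n H ∸ i)
  card⊇copy⇔ ℓ X {i} H+i≤ℓ S C = mk⇔
    (λ (∣C∣≡ℓ , S⊆C , ψ , ∣C∩∂∣≡i) → ψ , S⊆C , ∣C∩∂∣≡i , (begin
      ∣ C ─ ball1 X S ∣                            ≡⟨ m+n∸m≡n (n H + i) _ ⟨
      n H + i + ∣ C ─ ball1 X S ∣ ∸ (n H + i)      ≡⟨ cong (_∸ (n H + i)) (trans (sym (split S⊆C ψ ∣C∩∂∣≡i)) ∣C∣≡ℓ) ⟩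
      ℓ ∸ (n H + i)                                ≡⟨ ∸-+-assoc ℓ (n H) i ⟨
      ℓ ∸ n H ∸ i                                  ∎))
    (λ (ψ , S⊆C , ∣C∩∂∣≡i , ∣C─B₁∣≡) → (begin
      ∣ C ∣                                        ≡⟨ split S⊆C ψ ∣C∩∂∣≡i ⟩
      n H + i + ∣ C ─ ball1 X S ∣                  ≡⟨ cong (n H + i +_) (trans ∣C─B₁∣≡ (∸-+-assoc ℓ (n H) i)) ⟩
      n H + i + (ℓ ∸ (n H + i))                    ≡⟨ m+[n∸m]≡n H+i≤ℓ ⟩
      ℓ                                            ∎) , S⊆C , ψ , ∣C∩∂∣≡i)
    where
    open ≡-Reasoning
    split : S ⊆ C → X [ S ]≅ H → ∣ C ∩ ∂ X S ∣ ≡ i → ∣ C ∣ ≡ n H + i + ∣ C ─ ball1 X S ∣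
    split S⊆C ψ refl = trans (∣∣-split (S⊆ball1 X S) S⊆C) (cong (λ m → m + _ + _) (∣copy∣ ψ))

  deckCount-by-copies : ∀ ℓ (X : Graph) i → n H + i ≤ ℓ →
    deckCount ℓ X i ≡ ∑ (subsets (n X)) (λ S →
      ⟦ X [ S ]≅? H ⟧ * ((∣ ∂ X S ∣ choose i) * ((n X ∸ n H ∸ ∣ ∂ X S ∣) choose (ℓ ∸ n H ∸ i))))
  deckCount-by-copies ℓ X i H+i≤ℓ = begin
    ∑ (ℓ-subsets ℓ (n X)) (λ C → copiesMeeting∂ X C i)
      ≡⟨ ∑-filter (λ C → ∣ C ∣ ≟ ℓ) (subsets (n X)) _ ⟩
    ∑ (subsets (n X)) (λ C → ⟦ ∣ C ∣ ≟ ℓ ⟧ * copiesMeeting∂ X C i)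
      ≡⟨ ∑-cong (subsets (n X)) (λ {C} _ → trans (cong (⟦ ∣ C ∣ ≟ ℓ ⟧ *_) (∑-filter (_⊆? C) (subsets (n X)) _))
                                                 (sym (∑-*ˡ (subsets (n X)) ⟦ ∣ C ∣ ≟ ℓ ⟧ _))) ⟩
    ∑ (subsets (n X)) (λ C → ∑ (subsets (n X)) (λ S → pair S C))
      ≡⟨ ∑-comm (subsets (n X)) (subsets (n X)) (λ C S → pair S C) ⟩
    ∑ (subsets (n X)) (λ S → ∑ (subsets (n X)) (pair S))
      ≡⟨ ∑-cong (subsets (n X)) (λ {S} _ → cardsThroughCopy S) ⟩
    ∑ (subsets (n X)) (λ S →
      ⟦ X [ S ]≅? H ⟧ * ((∣ ∂ X S ∣ choose i) * ((n X ∸ n H ∸ ∣ ∂ X S ∣) choose (ℓ ∸ n H ∸ i)))) ∎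
    where
    open ≡-Reasoning
    pair : Subset (n X) → Subset (n X) → ℕ
    pair S C = ⟦ ∣ C ∣ ≟ ℓ ⟧ * (⟦ S ⊆? C ⟧ * (⟦ X [ S ]≅? H ⟧ * ⟦ ∣ C ∩ ∂ X S ∣ ≟ i ⟧))
    cardsThroughCopy : ∀ S → ∑ (subsets (n X)) (pair S) ≡
      ⟦ X [ S ]≅? H ⟧ * ((∣ ∂ X S ∣ choose i) * ((n X ∸ n H ∸ ∣ ∂ X S ∣) choose (ℓ ∸ n H ∸ i)))
    cardsThroughCopy S = begin
      ∑ (subsets (n X)) (pair S)
        ≡⟨ ∑-cong (subsets (n X)) (λ {C} _ → pair≡ C) ⟩
      ∑ (subsets (n X)) (λ C → ⟦ X [ S ]≅? H ⟧ * extension C)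
        ≡⟨ ∑-*ˡ (subsets (n X)) ⟦ X [ S ]≅? H ⟧ extension ⟩
      ⟦ X [ S ]≅? H ⟧ * ∑ (subsets (n X)) extension
        ≡⟨ ⟦⟧*-cong (X [ S ]≅? H) (λ ψ →
             trans (#supersets (S⊆ball1 X S) i β) (cong (λ m → (d choose i) * (m choose β)) (∣∁B₁∣ ψ))) ⟩
      ⟦ X [ S ]≅? H ⟧ * ((d choose i) * ((n X ∸ n H ∸ d) choose β)) ∎
      where
      d = ∣ ∂ X S ∣
      β = ℓ ∸ n H ∸ i
      ∣∁B₁∣ : X [ S ]≅ H → ∣ ∁ (ball1 X S) ∣ ≡ n X ∸ n H ∸ d
      ∣∁B₁∣ ψ = trans (∣∁p∣≡n∸∣p∣ (ball1 X S))
                     (trans (cong (n X ∸_) (∣ball1∣-copy ψ)) (sym (∸-+-assoc (n X) (n H) d)))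
      extension : Subset (n X) → ℕ
      extension C = ⟦ S ⊆? C ⟧ * (⟦ ∣ C ∩ ∂ X S ∣ ≟ i ⟧ * ⟦ ∣ C ─ ball1 X S ∣ ≟ β ⟧)
      pair≡ : ∀ C → pair S C ≡ ⟦ X [ S ]≅? H ⟧ * extension C
      pair≡ C = trans (⟦×⟧³ (∣ C ∣ ≟ ℓ) (S ⊆? C) (X [ S ]≅? H) (∣ C ∩ ∂ X S ∣ ≟ i))
        (trans (⟦⟧-cong (card⊇copy⇔ ℓ X H+i≤ℓ S C)
                  (∣ C ∣ ≟ ℓ ×-dec S ⊆? C ×-dec X [ S ]≅? H ×-dec ∣ C ∩ ∂ X S ∣ ≟ i)
                  (X [ S ]≅? H ×-dec S ⊆? C ×-dec ∣ C ∩ ∂ X S ∣ ≟ i ×-dec ∣ C ─ ball1 X S ∣ ≟ β))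
               (sym (⟦×⟧³ (X [ S ]≅? H) (S ⊆? C) (∣ C ∩ ∂ X S ∣ ≟ i) (∣ C ─ ball1 X S ∣ ≟ β))))

  copiesWith∂ : (X : Graph) → ℕ → ℕ
  copiesWith∂ X j = ∑ (subsets (n X)) (λ S → ⟦ X [ S ]≅? H ⟧ * ⟦ ∣ ∂ X S ∣ ≟ j ⟧)

  ∑-copies-by-∂ : ∀ (X : Graph) K → (∀ {S} → X [ S ]≅ H → ∣ ∂ X S ∣ < K) → (F : ℕ → ℕ) →
    ∑ (subsets (n X)) (λ S → ⟦ X [ S ]≅? H ⟧ * F ∣ ∂ X S ∣) ≡ ∑ (upTo K) (λ j → copiesWith∂ X j * F j)
  ∑-copies-by-∂ X K ∂<K F = begin
    ∑ (subsets (n X)) (λ S → ⟦ X [ S ]≅? H ⟧ * F ∣ ∂ X S ∣)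
      ≡⟨ ∑-cong (subsets (n X)) (λ {S} _ → sorted (X [ S ]≅? H) ∂<K) ⟩
    ∑ (subsets (n X)) (λ S → ∑ (upTo K) (λ j → ⟦ ∣ ∂ X S ∣ ≟ j ⟧ * (⟦ X [ S ]≅? H ⟧ * F j)))
      ≡⟨ ∑-comm (subsets (n X)) (upTo K) _ ⟩
    ∑ (upTo K) (λ j → ∑ (subsets (n X)) (λ S → ⟦ ∣ ∂ X S ∣ ≟ j ⟧ * (⟦ X [ S ]≅? H ⟧ * F j)))
      ≡⟨ ∑-cong (upTo K) (λ {j} _ →
           trans (∑-cong (subsets (n X)) (λ {S} _ → reorder ⟦ ∣ ∂ X S ∣ ≟ j ⟧ ⟦ X [ S ]≅? H ⟧ (F j)))
                                          (∑-*ʳ (subsets (n X)) (F j) _)) ⟩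
    ∑ (upTo K) (λ j → copiesWith∂ X j * F j) ∎
    where
    open ≡-Reasoning
    sorted : ∀ {P : Set} (P? : Dec P) {d} → (P → d < K) →
             ⟦ P? ⟧ * F d ≡ ∑ (upTo K) (λ j → ⟦ d ≟ j ⟧ * (⟦ P? ⟧ * F j))
    sorted (yes p) d<K = sym (∑-δ _≟_ (Unique.upTo⁺ K) (∈-upTo⁺ (d<K p)) (λ j → 1 * F j))
    sorted (no _) {d} _ = sym (∑-zero (upTo K) (λ {j} _ → *-zeroʳ ⟦ d ≟ j ⟧))
    reorder : ∀ a b c → a * (b * c) ≡ b * a * c
    reorder a b c = trans (sym (*-assoc a b c)) (cong (_* c) (*-comm a b))

  isolatedCopies : (X : Graph) → List (Subset (n X))
  isolatedCopies X = filter (λ S → X [ S ]≅? H ×-dec ∣ ∂ X S ∣ ≟ 0) (subsets (n X))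

  length-isolatedCopies : ∀ (X : Graph) → length (isolatedCopies X) ≡ copiesWith∂ X 0
  length-isolatedCopies X = begin
    length (isolatedCopies X)
      ≡⟨ length≡∑1 (isolatedCopies X) ⟩
    ∑ (isolatedCopies X) (λ _ → 1)
      ≡⟨ ∑-filter (λ S → X [ S ]≅? H ×-dec ∣ ∂ X S ∣ ≟ 0) (subsets (n X)) _ ⟩
    ∑ (subsets (n X)) (λ S → ⟦ X [ S ]≅? H ×-dec ∣ ∂ X S ∣ ≟ 0 ⟧ * 1)
      ≡⟨ ∑-cong (subsets (n X)) (λ {S} _ → trans (*-identityʳ _) (sym (⟦×⟧ (X [ S ]≅? H) (∣ ∂ X S ∣ ≟ 0)))) ⟩
    copiesWith∂ X 0 ∎
    where open ≡-Reasoning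

  component⇒connected : ∀ {X : Graph} {S : Subset (n X)} → ComponentIso X H S → Connected H
  component⇒connected (component , ψ) =
    nonempty-Iso ψ (IsComponent.nonempty component) , connectedIn-Iso ψ (IsComponent.connected component)

  component⇔isolatedCopy : ∀ {X : Graph} → Connected H → ∀ S → ComponentIso X H S ⇔ S ∈ₗ isolatedCopies X
  component⇔isolatedCopy {X} (nonempty , connected) S = mk⇔
    (λ (component , ψ) →
      ∈-filter⁺ _ (∈-subsets S) (ψ , Equivalence.to (closed⇔∣∂∣≡0 X S) (IsComponent.closed component)))
    (λ S∈ → let ψ , ∣∂∣≡0 = proj₂ (∈-filter⁻ (λ S → X [ S ]≅? H ×-dec ∣ ∂ X S ∣ ≟ 0) {xs = subsets (n X)} S∈) in
      record { nonempty  = nonempty-Iso (Iso-sym ψ) nonempty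
             ; connected = connectedIn-Iso (Iso-sym ψ) connected
             ; closed    = Equivalence.from (closed⇔∣∂∣≡0 X S) ∣∂∣≡0 } , ψ)

  #components : ∀ {X : Graph} → Connected H → NumComponentsIso X H (length (isolatedCopies X))
  #components {X} H-connected = isolatedCopies X , Unique.filter⁺ _ (subsets! (n X)) , refl ,
    λ S → let open Equivalence (component⇔isolatedCopy H-connected S) in from , to

  #components-unique : ∀ {X : Graph} {k k′} → NumComponentsIso X H k → NumComponentsIso X H k′ → k ≡ k′
  #components-unique (L , L! , refl , L⇔) (L′ , L′! , refl , L′⇔) =
    ↭.↭-length (∼bag⇒↭ (unique∧set⇒bag L! L′! (mk⇔ (λ S∈ → proj₂ (L′⇔ _) (proj₁ (L⇔ _) S∈))
                                                  (λ S∈ → proj₂ (L⇔ _) (proj₁ (L′⇔ _) S∈)))))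

  -- A component isomorphic to H makes H connected, and then such components are the copies
  -- with empty boundary.
  #components-transfer : ∀ {G G′ : Graph} {k} → copiesWith∂ G 0 ≡ copiesWith∂ G′ 0 →
    NumComponentsIso G H k → NumComponentsIso G′ H k
  #components-transfer {G} {G′} same count@(S ∷ _ , _ , _ , L⇔) =
    subst (NumComponentsIso G′ H) (sym k≡) (#components H-connected)
    where
    H-connected = component⇒connected (proj₁ (L⇔ S) (Any.here refl))
    k≡ = trans (#components-unique count (#components H-connected))
               (trans (length-isolatedCopies G) (trans same (sym (length-isolatedCopies G′))))
  #components-transfer {G} {G′} same ([] , _ , refl , L⇔) = [] , [] , refl , λ S → (λ ()) , noComponent S
    where
    inhabited : ∀ {A B : Set} {xs : List A} {ys : List B} {x} → length xs ≡ length ys → x ∈ₗ xs → ∃ (_∈ₗ ys)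
    inhabited {ys = y ∷ _} _ _ = y , Any.here refl
    inhabited {xs = _ ∷ _} {ys = []} () _
    noComponent : ∀ S → ComponentIso G′ H S → S ∈ₗ []
    noComponent S component = componentOfG (inhabited
      (trans (length-isolatedCopies G′) (trans (sym same) (sym (length-isolatedCopies G))))
      (Equivalence.to (component⇔isolatedCopy H-connected S) component))
      where
      H-connected = component⇒connected component
      componentOfG : ∃ (_∈ₗ isolatedCopies G) → S ∈ₗ []
      componentOfG (T , T∈) =
        contradiction (proj₂ (L⇔ T) (Equivalence.from (component⇔isolatedCopy H-connected T) T∈)) λ ()

  module _ (ℓ : ℕ) (H<ℓ : n H < ℓ) where
    private
      K = ℓ ∸ n H
      H+K≡ℓ : n H + K ≡ ℓ
      H+K≡ℓ = m+[n∸m]≡n (<⇒≤ H<ℓ)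

    SmallBoundaries : Graph → Set
    SmallBoundaries X = ∀ {S} → X [ S ]≅ H → ∣ ∂ X S ∣ < K

    small⇔deckCount≡0 : ∀ (X : Graph) → SmallBoundaries X ⇔ deckCount ℓ X K ≡ 0
    small⇔deckCount≡0 X = mk⇔ small⇒ ⇒small
      where
      rest : Subset (n X) → ℕ
      rest S = (n X ∸ n H ∸ ∣ ∂ X S ∣) choose (K ∸ K)
      term : Subset (n X) → ℕ
      term S = ⟦ X [ S ]≅? H ⟧ * ((∣ ∂ X S ∣ choose K) * rest S)
      count≡ : deckCount ℓ X K ≡ ∑ (subsets (n X)) term
      count≡ = deckCount-by-copies ℓ X K (≤-reflexive H+K≡ℓ)
      small⇒ : SmallBoundaries X → deckCount ℓ X K ≡ 0
      small⇒ small = trans count≡ (∑-zero (subsets (n X)) λ {S} _ →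
        trans (⟦⟧*-cong (X [ S ]≅? H) (λ ψ → cong (_* rest S) (k>n⇒nCk≡0 (small ψ)))) (*-zeroʳ ⟦ X [ S ]≅? H ⟧))
      ⇒small : deckCount ℓ X K ≡ 0 → SmallBoundaries X
      ⇒small count≡0 {S} ψ = ≰⇒> λ K≤∂ →
        >⇒≢ (0<term K≤∂) (∑≡0⇒ (subsets (n X)) term (trans (sym count≡) count≡0) (∈-subsets S))
        where
        0<term : K ≤ ∣ ∂ X S ∣ → 0 < term S
        0<term K≤∂ =
          subst (0 <_) (sym (trans (cong (_* ((∣ ∂ X S ∣ choose K) * rest S)) (⟦yes⟧ (X [ S ]≅? H) ψ)) (*-identityˡ _)))
          (*-pos (0<nCk K≤∂) (0<nCk (subst (_≤ n X ∸ n H ∸ ∣ ∂ X S ∣) (sym (n∸n≡0 K)) z≤n)))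

    -- the number of ℓ-subsets C ⊇ S with |C ∩ ∂S| = i, for a copy S with |∂S| = j in a graph of
    -- order N (see deckCount-by-copies)
    cardsThrough : ℕ → ℕ → ℕ → ℕ
    cardsThrough N j i = (j choose i) * ((N ∸ n H ∸ j) choose (K ∸ i))

    deckCount-by-∂ : ∀ (X : Graph) → SmallBoundaries X → ∀ {i} → i < K →
      deckCount ℓ X i ≡ ∑ (upTo K) (λ j → copiesWith∂ X j * cardsThrough (n X) j i)
    deckCount-by-∂ X small {i} i<K =
      trans (deckCount-by-copies ℓ X i H+i≤ℓ) (∑-copies-by-∂ X K small (λ d → cardsThrough (n X) d i))
      where
      H+i≤ℓ : n H + i ≤ ℓ
      H+i≤ℓ = ≤-trans (+-monoʳ-≤ (n H) (<⇒≤ i<K)) (≤-reflexive H+K≡ℓ)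

    copiesWith∂-deck : ∀ {G G′ : Graph} → ℓ ≤ n G → SameDeck ℓ G G′ → SmallBoundaries G →
      ∀ {j} → j < K → copiesWith∂ G j ≡ copiesWith∂ G′ j
    copiesWith∂-deck {G} {G′} ℓ≤n deck small =
      triangular-unique K (cardsThrough (n G)) upper diagonal (copiesWith∂ G) (copiesWith∂ G′) equations
      where
      small′ : SmallBoundaries G′
      small′ = Equivalence.from (small⇔deckCount≡0 G′)
                 (trans (sym (deckCount-deck deck K)) (Equivalence.to (small⇔deckCount≡0 G) small))
      n≡n′ : n G ≡ n G′
      n≡n′ = deck-order (≤-trans z<s H<ℓ) ℓ≤n deck
      upper : ∀ {j i} → j < i → cardsThrough (n G) j i ≡ 0
      upper {j} {i} j<i = cong (_* ((n G ∸ n H ∸ j) choose (K ∸ i))) (k>n⇒nCk≡0 j<i)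
      diagonal : ∀ {i} → i < K → NonZero (cardsThrough (n G) i i)
      diagonal {i} i<K = >-nonZero (*-pos (0<nCk {i} ≤-refl) (0<nCk (∸-monoˡ-≤ i (∸-monoˡ-≤ (n H) ℓ≤n))))
      system : Graph → ℕ → ℕ → ℕ
      system X N i = ∑ (upTo K) (λ j → copiesWith∂ X j * cardsThrough N j i)
      equations : ∀ {i} → i < K → system G (n G) i ≡ system G′ (n G) i
      equations {i} i<K = begin
        system G (n G) i    ≡⟨ deckCount-by-∂ G small i<K ⟨
        deckCount ℓ G i     ≡⟨ deckCount-deck deck i ⟩
        deckCount ℓ G′ i    ≡⟨ deckCount-by-∂ G′ small′ i<K ⟩
        system G′ (n G′) i  ≡⟨ cong (λ N → system G′ N i) n≡n′ ⟨
        system G′ (n G) i   ∎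
        where open ≡-Reasoning

corollary5p4 : (ℓ : ℕ) (H G : Graph) →
    suc (n H) ≤ ℓ → ℓ ≤ n G →
    ¬ (Σ (Subset (n G)) λ S → (G [ S ]≅ H) × (ℓ ≤ ∣ ball1 G S ∣)) →
    (G' : Graph) → SameDeck ℓ G G' →
    (k : ℕ) → NumComponentsIso G H k → NumComponentsIso G' H k
corollary5p4 ℓ H G H<ℓ ℓ≤n noLargeBall G′ deck k =
  #components-transfer (copiesWith∂-deck ℓ H<ℓ ℓ≤n deck small (m<n⇒0<n∸m H<ℓ))
  where
  open CopiesOf H
  small : SmallBoundaries ℓ H<ℓ G
  small {S} ψ = subst (_< _) (m+n∸m≡n (n H) _) (∸-monoˡ-< ball<ℓ (m≤m+n (n H) _))
    where
    ball<ℓ = ≰⇒> λ ℓ≤ → noLargeBall (S , ψ , subst (ℓ ≤_) (sym (∣ball1∣-copy ψ)) ℓ≤)
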